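{- Let $T,T'\in\mathcal{T}_n$ with $T\neq T'$. (i) The least $i\in\{1,\dots,n\}$ such that $(\mathrm{ld}_T(i)-\mathrm{ld}_{T'}(i),\mathrm{rd}_T(i)-\mathrm{rd}_{T'}(i))\neq(0,0)$ coincides with the least $i$ such that $\mathrm{ld}_T(i)\neq\mathrm{ld}_{T'}(i)$, and it satisfies $\mathrm{rd}_T(i)=\mathrm{rd}_{T'}(i)$. (ii) The greatest $i\in\{1,\dots,n\}$ such that $(\mathrm{ld}_T(i)-\mathrm{ld}_{T'}(i),\mathrm{rd}_T(i)-\mathrm{rd}_{T'}(i))\neq(0,0)$ coincides with the greatest $i$ such that $\mathrm{rd}_T(i)\neq\mathrm{rd}_{T'}(i)$, and it satisfies $\mathrm{ld}_T(i)=\mathrm{ld}_{T'}(i)$.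
   Context: $\mathcal{T}_n$ is the set of (isomorphism classes of) binary trees (rooted plane trees in which each internal vertex has an ordered left and right child) with $n$ leaves, numbered $1,\dots,n$ from left to right. For a leaf $i$, $\mathrm{ld}_T(i)$ and $\mathrm{rd}_T(i)$ are the numbers of left and right steps on the path from the root to $i$. -}

module Defs where

open import Data.Nat using (ℕ; zero; suc; _+_; _<_; _≤_)
open import Data.Product using (_×_; _,_)
open import Relation.Binary.PropositionalEquality using (_≡_)
open import Relation.Nullary using (¬_)

data Tree : Set where
  leaf : Tree
  node : Tree → Tree → Tree

leaves : Tree → ℕ
leaves leaf       = 1
leaves (node l r) = leaves l + leaves r

_∈𝒯_ : Tree → ℕ → Set
T ∈𝒯 n = leaves T ≡ n

-- Leaves are numbered 0,…,n-1 from left to right (paper: 1,…,n).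
-- ld T i / rd T i : number of left / right steps on the path from the root
-- to leaf i. (Value for out-of-range i is irrelevant; it is 0.)
ld : Tree → ℕ → ℕ
ld leaf       _ = 0
ld (node l r) i with i Data.Nat.<? leaves l
... | Relation.Nullary.yes _ = suc (ld l i)
... | Relation.Nullary.no  _ = ld r (i Data.Nat.∸ leaves l)

rd : Tree → ℕ → ℕ
rd leaf       _ = 0
rd (node l r) i with i Data.Nat.<? leaves l
... | Relation.Nullary.yes _ = rd l i
... | Relation.Nullary.no  _ = suc (rd r (i Data.Nat.∸ leaves l))

IsLeastBelow : ℕ → (ℕ → Set) → ℕ → Set
IsLeastBelow n P i = i < n × P i × (∀ j → j < i → ¬ P j)

IsGreatestBelow : ℕ → (ℕ → Set) → ℕ → Set
IsGreatestBelow n P i = i < n × P i × (∀ j → i < j → j < n → ¬ P j)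

PairDiff : Tree → Tree → ℕ → Set
PairDiff T T' i = ¬ ((ld T i , rd T i) ≡ (ld T' i , rd T' i))

-- If the left subtrees differ, the first
-- differing leaf lies in both left subtrees; otherwise the left subtrees are equal and
-- the first difference lies in the right subtrees, shifted by the same amount. At the
-- first differing leaf the two root paths are still in step to the right: in the base
-- case one tree is a single leaf, whose depths are (0,0), and the leftmost leaf of the
-- other has no right steps but at least one left step. Part (ii) is part (i) for the
-- mirror images, since mirroring reverses the order of the leaves and swaps ld and rd.
module Submission where

open import Defs
open import Data.Nat using (ℕ; zero; suc; _+_; _∸_; _<_; _≤_; _<?_; z<s; s<s; s≤s)
open import Data.Nat.Properties
  using ( suc-injective; 0≢1+n; <-irrefl; <-trans; <-≤-trans; ≰⇒>; <⇒≱; m≤m+n; m≤n+m; m+n≮m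
        ; +-comm; +-cancelˡ-≡; +-cancelʳ-≡; +-cancelˡ-<; +-cancelʳ-≤; +-monoˡ-≤; +-monoʳ-<; +-mono-≤-<
        ; m+n∸m≡n; m+[n∸m]≡n; module ≤-Reasoning )
open import Data.Nat.Tactic.RingSolver using (solve-∀)
open import Data.Product using (_×_; ∃; _,_; proj₁; proj₂; map₁; map₂; swap)
open import Function using (_∘_)
open import Relation.Nullary using (Dec; yes; no; contradiction)
open import Relation.Binary.PropositionalEquality
  using (_≡_; _≢_; refl; sym; trans; cong; cong₂; subst; subst₂; module ≡-Reasoning)

depths : Tree → ℕ → ℕ × ℕ
depths T i = ld T i , rd T i

data Position (l : ℕ) : ℕ → Set where
  inLeft  : ∀ {i} → i < l → Position l i
  inRight : ∀ k → Position l (l + k)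

position : ∀ l i → Position l i
position zero    i       = inRight i
position (suc l) zero    = inLeft z<s
position (suc l) (suc i) with position l i
... | inLeft i<l = inLeft (s<s i<l)
... | inRight k  = inRight k

depths-node-left : ∀ l r {i} → i < leaves l → depths (node l r) i ≡ map₁ suc (depths l i)
depths-node-left l r {i} i<l with i <? leaves l
... | yes _   = refl
... | no i≮l = contradiction i<l i≮l

depths-node-right : ∀ l r k → depths (node l r) (leaves l + k) ≡ map₂ suc (depths r k)
depths-node-right l r k with leaves l + k <? leaves l
... | yes l+k<l = contradiction l+k<l (m+n≮m (leaves l) k)
... | no _ rewrite m+n∸m≡n (leaves l) k = refl

0<leaves : ∀ T → 0 < leaves T
0<leaves leaf       = z<s
0<leaves (node l r) = <-≤-trans (0<leaves l) (m≤m+n (leaves l) (leaves r))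

rd-leftmost : ∀ T → rd T 0 ≡ 0
rd-leftmost leaf       = refl
rd-leftmost (node l r) = trans (cong proj₂ (depths-node-left l r (0<leaves l))) (rd-leftmost l)

ld-leftmost-node : ∀ l r → ld (node l r) 0 ≡ suc (ld l 0)
ld-leftmost-node l r = cong proj₁ (depths-node-left l r (0<leaves l))

node-injectiveˡ : ∀ {l r l' r'} → node l r ≡ node l' r' → l ≡ l'
node-injectiveˡ refl = refl

node-injectiveʳ : ∀ {l r l' r'} → node l r ≡ node l' r' → r ≡ r'
node-injectiveʳ refl = refl

_≟_ : (A B : Tree) → Dec (A ≡ B)
leaf     ≟ leaf       = yes refl
leaf     ≟ node _ _   = no λ ()
node _ _ ≟ leaf       = no λ ()
node l r ≟ node l' r' with l ≟ l' | r ≟ r'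
... | yes refl | yes refl = yes refl
... | no l≢l'  | _        = no (l≢l' ∘ node-injectiveˡ)
... | yes _    | no r≢r'  = no (r≢r' ∘ node-injectiveʳ)

record FirstDifference (A B : Tree) : Set where
  field
    index         : ℕ
    index<leaves₁ : index < leaves A
    index<leaves₂ : index < leaves B
    agree-below   : ∀ {j} → j < index → depths A j ≡ depths B j
    ld-differs    : ld A index ≢ ld B index
    rd-agrees     : rd A index ≡ rd B index

FirstDifference-sym : ∀ {A B} → FirstDifference A B → FirstDifference B A
FirstDifference-sym d = record
  { index         = index
  ; index<leaves₁ = index<leaves₂
  ; index<leaves₂ = index<leaves₁
  ; agree-below   = sym ∘ agree-below
  ; ld-differs    = ld-differs ∘ sym
  ; rd-agrees     = sym rd-agrees
  }
  where open FirstDifference d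

FirstDifference-leaf-node : ∀ l r → FirstDifference leaf (node l r)
FirstDifference-leaf-node l r = record
  { index         = 0
  ; index<leaves₁ = z<s
  ; index<leaves₂ = 0<leaves (node l r)
  ; agree-below   = λ ()
  ; ld-differs    = λ e → 0≢1+n (trans e (ld-leftmost-node l r))
  ; rd-agrees     = sym (rd-leftmost (node l r))
  }

FirstDifference-nodeˡ : ∀ {l l'} r r' → FirstDifference l l' → FirstDifference (node l r) (node l' r')
FirstDifference-nodeˡ {l} {l'} r r' d = record
  { index         = index
  ; index<leaves₁ = <-≤-trans index<leaves₁ (m≤m+n (leaves l) (leaves r))
  ; index<leaves₂ = <-≤-trans index<leaves₂ (m≤m+n (leaves l') (leaves r'))
  ; agree-below   = λ j<i → subst₂ _≡_ (sym (depths-node-left l r (<-trans j<i index<leaves₁)))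
                                       (sym (depths-node-left l' r' (<-trans j<i index<leaves₂)))
                                       (cong (map₁ suc) (agree-below j<i))
  ; ld-differs    = ld-differs ∘ suc-injective ∘ subst₂ _≡_ (cong proj₁ unfold₁) (cong proj₁ unfold₂)
  ; rd-agrees     = subst₂ _≡_ (sym (cong proj₂ unfold₁)) (sym (cong proj₂ unfold₂)) rd-agrees
  }
  where
    open FirstDifference d
    unfold₁ = depths-node-left l r index<leaves₁
    unfold₂ = depths-node-left l' r' index<leaves₂

FirstDifference-nodeʳ : ∀ l {r r'} → FirstDifference r r' → FirstDifference (node l r) (node l r')
FirstDifference-nodeʳ l {r} {r'} d = record
  { index         = leaves l + index
  ; index<leaves₁ = +-monoʳ-< (leaves l) index<leaves₁
  ; index<leaves₂ = +-monoʳ-< (leaves l) index<leaves₂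
  ; agree-below   = agree-below′
  ; ld-differs    = ld-differs ∘ subst₂ _≡_ (cong proj₁ unfold₁) (cong proj₁ unfold₂)
  ; rd-agrees     = subst₂ _≡_ (sym (cong proj₂ unfold₁)) (sym (cong proj₂ unfold₂)) (cong suc rd-agrees)
  }
  where
    open FirstDifference d
    unfold₁ = depths-node-right l r index
    unfold₂ = depths-node-right l r' index
    agree-below′ : ∀ {j} → j < leaves l + index → depths (node l r) j ≡ depths (node l r') j
    agree-below′ {j} j<l+i with position (leaves l) j
    ... | inLeft j<l = trans (depths-node-left l r j<l) (sym (depths-node-left l r' j<l))
    ... | inRight k  = subst₂ _≡_ (sym (depths-node-right l r k)) (sym (depths-node-right l r' k))
                                  (cong (map₂ suc) (agree-below (+-cancelˡ-< (leaves l) k index j<l+i)))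

firstDifference : ∀ {A B} → A ≢ B → FirstDifference A B
firstDifference {leaf}     {leaf}       A≢B = contradiction refl A≢B
firstDifference {leaf}     {node l r}   _   = FirstDifference-leaf-node l r
firstDifference {node l r} {leaf}       _   = FirstDifference-sym (FirstDifference-leaf-node l r)
firstDifference {node l r} {node l' r'} A≢B with l ≟ l'
... | no l≢l'  = FirstDifference-nodeˡ r r' (firstDifference l≢l')
... | yes refl = FirstDifference-nodeʳ l (firstDifference (A≢B ∘ cong (node l)))

mirror : Tree → Tree
mirror leaf       = leaf
mirror (node l r) = node (mirror r) (mirror l)

mirror-involutive : ∀ T → mirror (mirror T) ≡ T
mirror-involutive leaf       = refl
mirror-involutive (node l r) = cong₂ node (mirror-involutive l) (mirror-involutive r)

mirror-injective : ∀ {A B} → mirror A ≡ mirror B → A ≡ B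
mirror-injective {A} {B} e = subst₂ _≡_ (mirror-involutive A) (mirror-involutive B) (cong mirror e)

leaves-mirror : ∀ T → leaves (mirror T) ≡ leaves T
leaves-mirror leaf       = refl
leaves-mirror (node l r) = trans (cong₂ _+_ (leaves-mirror r) (leaves-mirror l)) (+-comm (leaves r) (leaves l))

-- An equation suc (i + j) ≡ n says that, among n leaves, leaf i counted from the left is
-- leaf j counted from the right.
reflect : ∀ {i n} → i < n → suc (i + (n ∸ suc i)) ≡ n
reflect = m+[n∸m]≡n

reflected-sym : ∀ {i j n} → suc (i + j) ≡ n → suc (j + i) ≡ n
reflected-sym {i} {j} e = trans (cong suc (+-comm j i)) e

reflected-< : ∀ {i j n} → suc (i + j) ≡ n → j < n
reflected-< {i} {j} e = subst (j <_) e (s≤s (m≤n+m j i))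

reflected-antitone : ∀ {i j i' j' n} → suc (i + j) ≡ n → suc (i' + j') ≡ n → j < j' → i' < i
reflected-antitone e e' j<j' = ≰⇒> λ i≤i' → <-irrefl (trans e (sym e')) (s≤s (+-mono-≤-< i≤i' j<j'))

reflected-≥ : ∀ {i j a b} → suc (i + j) ≡ a + b → i < b → a ≤ j
reflected-≥ {i} {j} {a} {b} e i<b = +-cancelʳ-≤ b a j (begin
  a + b     ≡⟨ e ⟨
  suc i + j ≤⟨ +-monoˡ-≤ j i<b ⟩
  b + j     ≡⟨ +-comm b j ⟩
  j + b     ∎)
  where open ≤-Reasoning

reflected-cancelˡ : ∀ {i a k b} → suc (i + (a + k)) ≡ a + b → suc (i + k) ≡ b
reflected-cancelˡ {i} {a} {k} e = +-cancelˡ-≡ a _ _ (trans (shuffle i a k) e)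
  where
    shuffle : ∀ i a k → a + suc (i + k) ≡ suc (i + (a + k))
    shuffle = solve-∀

reflected-cancelʳ : ∀ {b k j a} → suc ((b + k) + j) ≡ a + b → suc (k + j) ≡ a
reflected-cancelʳ {b} {k} {j} e = +-cancelʳ-≡ b _ _ (trans (shuffle b k j) e)
  where
    shuffle : ∀ b k j → suc (k + j) + b ≡ suc ((b + k) + j)
    shuffle = solve-∀

depths-mirror : ∀ T {i j} → suc (i + j) ≡ leaves T → depths (mirror T) i ≡ swap (depths T j)
depths-mirror leaf {zero}  {zero}  _  = refl
depths-mirror leaf {zero}  {suc _} ()
depths-mirror leaf {suc _}         ()
depths-mirror (node l r) {i} {j} e with position (leaves (mirror r)) i
... | inLeft i<r with position (leaves l) j
...   | inLeft j<l = contradiction (reflected-≥ e (subst (i <_) (leaves-mirror r) i<r)) (<⇒≱ j<l)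
...   | inRight k  = begin
  depths (node (mirror r) (mirror l)) i   ≡⟨ depths-node-left (mirror r) (mirror l) i<r ⟩
  map₁ suc (depths (mirror r) i)          ≡⟨ cong (map₁ suc) (depths-mirror r {i} {k} (reflected-cancelˡ {i} e)) ⟩
  swap (map₂ suc (depths r k))            ≡⟨ cong swap (depths-node-right l r k) ⟨
  swap (depths (node l r) (leaves l + k)) ∎
  where open ≡-Reasoning
depths-mirror (node l r) {j = j} e | inRight k = begin
  depths (node (mirror r) (mirror l)) (leaves (mirror r) + k) ≡⟨ depths-node-right (mirror r) (mirror l) k ⟩
  map₂ suc (depths (mirror l) k)                              ≡⟨ cong (map₂ suc) (depths-mirror l {k} {j} k+j) ⟩
  swap (map₁ suc (depths l j))                                ≡⟨ cong swap (depths-node-left l r (reflected-< k+j)) ⟨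
  swap (depths (node l r) j)                                  ∎
  where
    open ≡-Reasoning
    k+j : suc (k + j) ≡ leaves l
    k+j = reflected-cancelʳ (subst (λ b → suc (b + k + j) ≡ leaves l + leaves r) (leaves-mirror r) e)

record LastDifference (A B : Tree) : Set where
  field
    index        : ℕ
    index<leaves : index < leaves A
    agree-above  : ∀ {j} → index < j → j < leaves A → depths A j ≡ depths B j
    rd-differs   : rd A index ≢ rd B index
    ld-agrees    : ld A index ≡ ld B index

lastDifference : ∀ {A B} → A ≢ B → leaves A ≡ leaves B → LastDifference A B
lastDifference {A} {B} A≢B same = record
  { index        = j
  ; index<leaves = reflected-< i+j
  ; agree-above  = agree-above
  ; rd-differs   = ld-differs ∘ subst₂ _≡_ (sym (cong proj₁ (mirror₁ i+j))) (sym (cong proj₁ (mirror₂ i+j)))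
  ; ld-agrees    = subst₂ _≡_ (cong proj₂ (mirror₁ i+j)) (cong proj₂ (mirror₂ i+j)) rd-agrees
  }
  where
    open FirstDifference (firstDifference (A≢B ∘ mirror-injective))
    mirror₁ : ∀ {i j} → suc (i + j) ≡ leaves A → depths (mirror A) i ≡ swap (depths A j)
    mirror₁ = depths-mirror A
    mirror₂ : ∀ {i j} → suc (i + j) ≡ leaves A → depths (mirror B) i ≡ swap (depths B j)
    mirror₂ e = depths-mirror B (trans e same)
    j = leaves A ∸ suc index
    i+j : suc (index + j) ≡ leaves A
    i+j = reflect (subst (index <_) (leaves-mirror A) index<leaves₁)
    agree-above : ∀ {j'} → j < j' → j' < leaves A → depths A j' ≡ depths B j'
    agree-above {j'} j<j' j'<n = cong swap (subst₂ _≡_ (mirror₁ i'+j') (mirror₂ i'+j')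
                                                     (agree-below (reflected-antitone i+j i'+j' j<j')))
      where
        i'+j' = reflected-sym {j'} (reflect j'<n)

FirstDifference-isLeast : ∀ {A B} (d : FirstDifference A B) → IsLeastBelow (leaves A) (PairDiff A B) (FirstDifference.index d)
FirstDifference-isLeast d = index<leaves₁ , ld-differs ∘ cong proj₁ , λ j j<i differ → differ (agree-below j<i)
  where open FirstDifference d

LastDifference-isGreatest : ∀ {A B} (d : LastDifference A B) → IsGreatestBelow (leaves A) (PairDiff A B) (LastDifference.index d)
LastDifference-isGreatest d = index<leaves , rd-differs ∘ cong proj₂ , λ j i<j j<n differ → differ (agree-above i<j j<n)
  where open LastDifference d

isLeastBelow-⊆ : ∀ {n i} {P Q : ℕ → Set} → (∀ {j} → P j → Q j) → IsLeastBelow n Q i → P i → IsLeastBelow n P i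
isLeastBelow-⊆ P⊆Q (i<n , _ , least) Pi = i<n , Pi , λ j j<i → least j j<i ∘ P⊆Q

isGreatestBelow-⊆ : ∀ {n i} {P Q : ℕ → Set} → (∀ {j} → P j → Q j) → IsGreatestBelow n Q i → P i → IsGreatestBelow n P i
isGreatestBelow-⊆ P⊆Q (i<n , _ , greatest) Pi = i<n , Pi , λ j i<j j<n → greatest j i<j j<n ∘ P⊆Q

lemma2p4 : (n : ℕ) (T T' : Tree) → T ∈𝒯 n → T' ∈𝒯 n → T ≢ T'
    → (∃ λ i → IsLeastBelow n (PairDiff T T') i
                × IsLeastBelow n (λ j → ld T j ≢ ld T' j) i
                × rd T i ≡ rd T' i)
    × (∃ λ i → IsGreatestBelow n (PairDiff T T') i
                × IsGreatestBelow n (λ j → rd T j ≢ rd T' j) i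
                × ld T i ≡ ld T' i)
lemma2p4 _ T T' refl T'∈𝒯n T≢T' =
    (F.index , isLeast , isLeastBelow-⊆ (_∘ cong proj₁) isLeast F.ld-differs , F.rd-agrees)
  , (L.index , isGreatest , isGreatestBelow-⊆ (_∘ cong proj₂) isGreatest L.rd-differs , L.ld-agrees)
  where
    first = firstDifference T≢T'
    last  = lastDifference T≢T' (sym T'∈𝒯n)
    module F = FirstDifference first
    module L = LastDifference last
    isLeast    = FirstDifference-isLeast first
    isGreatest = LastDifference-isGreatest last
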